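{- Let $r,k\geq 2$. (i) For all $1\leq \ell\leq \frac{k}{2}$, $\hat{R}_r(P_{n}^{(k, \ell)}) \leq \hat{R}_r\big(P_{\frac{n-\ell}{k-\ell}+1}\big)$. (ii) For all $n\geq k$, $1\leq \ell\leq k-1$, and $d\geq 1$ such that $d$ divides $n$, $k$, and $\ell$, $\hat{R}_r(P_{n}^{(k, \ell)})\leq \hat{R}_r(P_{n/d}^{(k/d,\ell/d)})$. (iii) For $1\leq \ell\leq k-1$ and $1 \le m < \frac{k}{k-\ell}$, $\hat{R}_r(P_{\ell+(m+1)(k-\ell)}^{(k,\ell)} ) \le \hat{R}_r(P_{\ell-1+(m+1)(k-\ell)}^{(k-1,\ell-1)})$.
   Context: A $k$-graph is a $k$-uniform hypergraph. For hypergraphs $G,H$ and an integer $r\ge 1$, $G\to_r H$ means that every $r$-coloring of the edges of $G$ contains a monochromatic copy of $H$; for a $k$-graph $H$, $\hat R_r(H)$ is the minimum number of edges of a $k$-graph $G$ with $G\to_r H$. For $0\le \ell\le k-1$ and $m\ge 1$, the $(k,\ell)$-path with $m$ edges is the $k$-graph with vertex set $\{v_1,\dots,v_{k+(m-1)(k-\ell)}\}$ and edges $\{v_{(i-1)(k-\ell)+1},\dots,v_{(i-1)(k-\ell)+k}\}$ for $i\in[m]$; $P_n^{(k,\ell)}$ denotes the $(k,\ell)$-path with $n$ vertices. $P_n$ denotes the graph path on $n$ vertices. -}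

module Defs where

open import Data.Nat using (ℕ; zero; suc; _+_; _*_; _∸_; _≤_; _<_; _≤ᵇ_; _<ᵇ_)
open import Data.Bool using (_∧_)
open import Data.Fin using (Fin; toℕ)
open import Data.Fin.Subset using (Subset; _∈_; ∣_∣)
open import Data.Vec using (tabulate)
open import Data.Product using (Σ; ∃; _×_)
open import Function.Definitions using (Injective)
open import Function.Bundles using (_⇔_)
open import Relation.Binary.PropositionalEquality using (_≡_)

record Hypergraph : Set where
  field
    nV   : ℕ
    nE   : ℕ
    edge : Fin nE → Subset nV
open Hypergraph public

-- G is a k-graph: every edge has exactly k vertices, and edges are distinct
-- (so nE G is the number of edges).
IsKGraph : ℕ → Hypergraph → Set
IsKGraph k G = (∀ i → ∣ edge G i ∣ ≡ k) × Injective _≡_ _≡_ (edge G)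

IsImage : ∀ {m n} → (Fin m → Fin n) → Subset m → Subset n → Set
IsImage {m} φ e f = ∀ y → (y ∈ f) ⇔ (Σ (Fin m) λ x → (x ∈ e) × (φ x ≡ y))

MonoCopy : ∀ {r} (G H : Hypergraph) → (Fin (nE G) → Fin r) → Set
MonoCopy {r} G H c =
  Σ (Fin (nV H) → Fin (nV G)) λ φ → Injective _≡_ _≡_ φ ×
  Σ (Fin (nE H) → Fin (nE G)) λ ψ →
    (∀ j → IsImage φ (edge H j) (edge G (ψ j))) ×
    Σ (Fin r) λ a → ∀ j → c (ψ j) ≡ a

Arrows : ℕ → Hypergraph → Hypergraph → Set
Arrows r G H = (c : Fin (nE G) → Fin r) → MonoCopy G H c

IsSizeRamsey : ℕ → ℕ → Hypergraph → ℕ → Set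
IsSizeRamsey r k H s =
  (Σ Hypergraph λ G → IsKGraph k G × nE G ≡ s × Arrows r G H) ×
  (∀ G → IsKGraph k G → Arrows r G H → s ≤ nE G)

-- The (k,ℓ)-path with m edges: vertices 0,…,k+(m-1)(k-ℓ)-1 (0-indexed),
-- the i-th edge (i = 0,…,m-1) is {i(k-ℓ), …, i(k-ℓ)+k-1}.
kPath : ℕ → ℕ → ℕ → Hypergraph
kPath k ℓ m = record
  { nV   = k + (m ∸ 1) * (k ∸ ℓ)
  ; nE   = m
  ; edge = λ i → tabulate λ v →
      (toℕ i * (k ∸ ℓ) ≤ᵇ toℕ v) ∧ (toℕ v <ᵇ toℕ i * (k ∸ ℓ) + k)
  }

graphPath : ℕ → Hypergraph
graphPath n = record
  { nV   = n
  ; nE   = n ∸ 1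
  ; edge = λ i → tabulate λ v → (toℕ i ≤ᵇ toℕ v) ∧ (toℕ v ≤ᵇ suc (toℕ i))
  }

{-# OPTIONS --safe #-}
-- Each bound comes from an operation G ↦ G⁺ on host hypergraphs that keeps the edge set:
-- (i) replace every vertex by ℓ copies and add k - 2ℓ new vertices to every edge, (ii) replace
-- every vertex by d copies, (iii) add one new vertex to all edges. It turns k′-graphs into
-- k-graphs and a copy of the shorter path P in G into a copy of P⁺ in G⁺ on the same edges, and
-- P⁺ is the longer path. Since a colouring of G⁺ is a colouring of G, a host G with G →r P of
-- minimum size gives G⁺ →r P⁺ with as many edges.
module Submission where

open import Defs
open import Data.Nat using (ℕ; NonZero; zero; suc; _+_; _*_; _∸_; _/_; _%_; _≤_; _<_; _≤ᵇ_; _<ᵇ_; s≤s; s≤s⁻¹)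
open import Data.Nat.Properties using (+-identityʳ; +-assoc; +-comm; +-suc; +-cancelˡ-≡; +-cancelˡ-<; +-monoʳ-<; +-monoʳ-≤; +-monoˡ-≤; *-comm; *-assoc; *-distribʳ-+; *-distribʳ-∸; *-monoˡ-≤; *-cancelʳ-<; ≤-refl; ≤-trans; ≤-antisym; ≤-<-trans; <-≤-trans; <-irrefl; m≤m+n; m≤n+m; n≤1+n; n<1+n; m+n∸m≡n; m+[n∸m]≡n; ∸-monoˡ-<; ≮⇒≥; _<?_; ≤ᵇ⇒≤; ≤⇒≤ᵇ; <ᵇ⇒<; <⇒<ᵇ; m≤n⇒∃[o]m+o≡n; +-commutativeSemigroup)
open import Data.Nat.DivMod using (m≡m%n+[m/n]*n; m%n<n)
open import Algebra.Properties.CommutativeSemigroup +-commutativeSemigroup using (x∙yz≈y∙xz)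
open import Data.Nat.Divisibility using (_∣_)
open import Data.Bool using (Bool; true; T)
open import Data.Bool.Properties using (T-≡; T-∧)
open import Data.Empty using (⊥-elim)
open import Data.Fin using (Fin; zero; suc; toℕ; fromℕ<; inject₁; cast; combine; remQuot; quotient; remainder; _↑ˡ_; _↑ʳ_; splitAt; join; lift; punchIn; punchOut; _≟_)
open import Data.Fin.Properties using (toℕ-injective; toℕ<n; toℕ-fromℕ<; toℕ-inject₁; toℕ-cast; cast-involutive; toℕ-combine; combine-surjective; combine-injective; remQuot-combine; splitAt-↑ˡ; splitAt-↑ʳ; splitAt⁻¹-↑ˡ; splitAt⁻¹-↑ʳ; ↑ˡ-injective; ↑ʳ-injective; lift-injective; punchIn-injective; punchInᵢ≢i; punchIn-punchOut)
open import Data.Fin.Subset using (Subset; _∈_; ∣_∣; ⁅_⁆; ⊤; ⊥; inside; outside)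
open import Data.Fin.Subset.Properties using (⊆-antisym; ∣⊤∣≡n; ∣⊥∣≡0; ∣⁅x⁆∣≡1; x∈⁅x⁆; x∈⁅y⁆⇒x≡y; x∈⁅y⁆⇔x≡y)
open import Data.Vec using ([]; _∷_; _++_; concat; map; replicate; lookup; tabulate; here; there)
open import Data.Vec.Properties using ([]=⇒lookup; lookup⇒[]=; lookup-++ˡ; lookup-++ʳ; lookup-concat; lookup-map; lookup-replicate; lookup∘tabulate; ++-injectiveˡ; ∷-injectiveʳ)
open import Data.Product using (Σ; _×_; _,_; proj₁; proj₂)
open import Data.Product.Function.NonDependent.Propositional using (_×-⇔_)
open import Data.Sum using (inj₁; inj₂; [_,_]′)
import Data.Sum as Sum
open import Function using (_∘_; id; const)
open import Function.Bundles using (_⇔_; mk⇔; Equivalence)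
open import Function.Construct.Composition using (_⇔-∘_)
open import Function.Construct.Identity using (⇔-id)
open import Function.Construct.Symmetry using (⇔-sym)
open import Function.Definitions using (Injective; StrictlySurjective)
open import Function.Related.Propositional using (module EquationalReasoning)
open import Relation.Binary.PropositionalEquality using (_≡_; _≢_; refl; sym; trans; cong; cong₂; subst; subst₂; module ≡-Reasoning)
open import Relation.Nullary using (yes; no)

private variable
  m n m′ n′ d w : ℕ

∈⇔lookup : ∀ {p : Subset n} {x} → x ∈ p ⇔ lookup p x ≡ true
∈⇔lookup {p = p} {x} = mk⇔ []=⇒lookup (lookup⇒[]= x p)

∈-cong-lookup : ∀ {p : Subset m} {q : Subset n} {x y} → lookup p x ≡ lookup q y → x ∈ p ⇔ y ∈ q
∈-cong-lookup {p = p} {q} {x} {y} eq = begin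
  x ∈ p               ∼⟨ ∈⇔lookup ⟩
  lookup p x ≡ true   ≡⟨ cong (_≡ true) eq ⟩
  lookup q y ≡ true   ∼⟨ ⇔-sym ∈⇔lookup ⟩
  y ∈ q               ∎
  where open EquationalReasoning

∈-tabulate : ∀ {n} (f : Fin n → Bool) x → x ∈ tabulate f ⇔ T (f x)
∈-tabulate f x = begin
  x ∈ tabulate f               ∼⟨ ∈⇔lookup ⟩
  lookup (tabulate f) x ≡ true ≡⟨ cong (_≡ true) (lookup∘tabulate f x) ⟩
  f x ≡ true                   ∼⟨ ⇔-sym T-≡ ⟩
  T (f x)                      ∎
  where open EquationalReasoning

subset-ext : {p q : Subset n} → (∀ x → x ∈ p ⇔ x ∈ q) → p ≡ q
subset-ext p⇔q = ⊆-antisym (Equivalence.to (p⇔q _)) (Equivalence.from (p⇔q _))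

∈-++ˡ : ∀ (p : Subset m) (q : Subset n) x → x ↑ˡ n ∈ p ++ q ⇔ x ∈ p
∈-++ˡ p q x = ∈-cong-lookup (lookup-++ˡ p q x)

∈-++ʳ : ∀ (p : Subset m) (q : Subset n) x → m ↑ʳ x ∈ p ++ q ⇔ x ∈ q
∈-++ʳ p q x = ∈-cong-lookup (lookup-++ʳ p q x)

∣++∣ : ∀ (p : Subset m) (q : Subset n) → ∣ p ++ q ∣ ≡ ∣ p ∣ + ∣ q ∣
∣++∣ []            q = refl
∣++∣ (inside ∷ p)  q = cong suc (∣++∣ p q)
∣++∣ (outside ∷ p) q = ∣++∣ p q

blow : ∀ d → Subset n → Subset (n * d)
blow d p = concat (map (replicate d) p)

∈-blow : ∀ d (p : Subset n) x t → combine x t ∈ blow d p ⇔ x ∈ p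
∈-blow d p x t = ∈-cong-lookup (begin
  lookup (blow d p) (combine x t)           ≡⟨ lookup-concat (map (replicate d) p) x t ⟩
  lookup (lookup (map (replicate d) p) x) t ≡⟨ cong (λ v → lookup v t) (lookup-map x (replicate d) p) ⟩
  lookup (replicate d (lookup p x)) t       ≡⟨ lookup-replicate t (lookup p x) ⟩
  lookup p x                                ∎)
  where open ≡-Reasoning

∣blow∣ : ∀ d (p : Subset n) → ∣ blow d p ∣ ≡ ∣ p ∣ * d
∣blow∣ d []            = refl
∣blow∣ d (inside ∷ p)  = trans (∣++∣ (⊤ {d}) (blow d p)) (cong₂ _+_ (∣⊤∣≡n d) (∣blow∣ d p))
∣blow∣ d (outside ∷ p) = trans (∣++∣ (⊥ {d}) (blow d p)) (cong₂ _+_ (∣⊥∣≡0 d) (∣blow∣ d p))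

blow-injective : Injective _≡_ _≡_ (blow {n} (suc d))
blow-injective {d = d} {p} {q} eq = subset-ext λ x → begin
  x ∈ p                           ∼⟨ ⇔-sym (∈-blow (suc d) p x zero) ⟩
  combine x zero ∈ blow (suc d) p ≡⟨ cong (combine x zero ∈_) eq ⟩
  combine x zero ∈ blow (suc d) q ∼⟨ ∈-blow (suc d) q x zero ⟩
  x ∈ q                           ∎
  where open EquationalReasoning

data SplitView m n : Fin (m + n) → Set where
  inl : (x : Fin m) → SplitView m n (x ↑ˡ n)
  inr : (x : Fin n) → SplitView m n (m ↑ʳ x)

splitView : ∀ m {n} (x : Fin (m + n)) → SplitView m n x
splitView m x with splitAt m x in eq
... | inj₁ y = subst (SplitView m _) (splitAt⁻¹-↑ˡ eq) (inl y)
... | inj₂ y = subst (SplitView m _) (splitAt⁻¹-↑ʳ eq) (inr y)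

data CombineView m n : Fin (m * n) → Set where
  pair : (x : Fin m) (t : Fin n) → CombineView m n (combine x t)

combineView : ∀ m n (x : Fin (m * n)) → CombineView m n x
combineView m n x with combine-surjective {m} {n} x
... | y , t , refl = pair y t

↑ˡ≢↑ʳ : ∀ (x : Fin m) (y : Fin n) → x ↑ˡ n ≢ m ↑ʳ y
↑ˡ≢↑ʳ {m} {n} x y eq with trans (sym (splitAt-↑ˡ m x n)) (trans (cong (splitAt m) eq) (splitAt-↑ʳ m n y))
... | ()

blowMap : ∀ d → (Fin m → Fin n) → Fin (m * d) → Fin (n * d)
blowMap {m} d f x = combine (f (quotient {m} d x)) (remainder {m} d x)

blowMap-combine : ∀ (f : Fin m → Fin n) (x : Fin m) (t : Fin d) → blowMap d f (combine x t) ≡ combine (f x) t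
blowMap-combine f x t = cong (λ (y , u) → combine (f y) u) (remQuot-combine x t)

blowMap-injective : ∀ {f : Fin m → Fin n} → Injective _≡_ _≡_ f → Injective _≡_ _≡_ (blowMap d f)
blowMap-injective {m} {d = d} {f} f-inj {x} {x′} eq with combineView m d x | combineView m d x′
... | pair y t | pair y′ t′ with combine-injective (f y) t (f y′) t′
                                  (trans (sym (blowMap-combine f y t)) (trans eq (blowMap-combine f y′ t′)))
... | fy≡fy′ , refl = cong (λ z → combine z t) (f-inj fy≡fy′)

_⊕_ : (Fin m → Fin m′) → (Fin n → Fin n′) → Fin (m + n) → Fin (m′ + n′)
_⊕_ {m} f g = join _ _ ∘ Sum.map f g ∘ splitAt m

⊕-↑ˡ : ∀ (f : Fin m → Fin m′) (g : Fin n → Fin n′) x → (f ⊕ g) (x ↑ˡ n) ≡ f x ↑ˡ n′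
⊕-↑ˡ {m} {n = n} f g x = cong (join _ _ ∘ Sum.map f g) (splitAt-↑ˡ m x n)

⊕-↑ʳ : ∀ (f : Fin m → Fin m′) (g : Fin n → Fin n′) x → (f ⊕ g) (m ↑ʳ x) ≡ m′ ↑ʳ g x
⊕-↑ʳ {m} {n = n} f g x = cong (join _ _ ∘ Sum.map f g) (splitAt-↑ʳ m n x)

⊕-injective : ∀ {f : Fin m → Fin m′} {g : Fin n → Fin n′} →
  Injective _≡_ _≡_ f → Injective _≡_ _≡_ g → Injective _≡_ _≡_ (f ⊕ g)
⊕-injective {m} {n = n} {f = f} {g = g} f-inj g-inj {x} {x′} eq with splitView m x | splitView m x′
... | inl y | inl y′ = cong (_↑ˡ n) (f-inj (↑ˡ-injective _ _ _ (trans (sym (⊕-↑ˡ f g y)) (trans eq (⊕-↑ˡ f g y′)))))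
... | inl y | inr y′ = ⊥-elim (↑ˡ≢↑ʳ (f y) (g y′) (trans (sym (⊕-↑ˡ f g y)) (trans eq (⊕-↑ʳ f g y′))))
... | inr y | inl y′ = ⊥-elim (↑ˡ≢↑ʳ (f y′) (g y) (trans (sym (⊕-↑ˡ f g y′)) (trans (sym eq) (⊕-↑ʳ f g y))))
... | inr y | inr y′ = cong (m ↑ʳ_) (g-inj (↑ʳ-injective _ _ _ (trans (sym (⊕-↑ʳ f g y)) (trans eq (⊕-↑ʳ f g y′)))))

mkImage : ∀ {φ : Fin m → Fin n} {e f} → (∀ x → x ∈ e → φ x ∈ f) →
  (∀ y → y ∈ f → Σ (Fin m) λ x → x ∈ e × φ x ≡ y) → IsImage φ e f
mkImage maps covers y = mk⇔ (covers y) λ { (x , x∈e , refl) → maps x x∈e }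

image-maps : ∀ {φ : Fin m → Fin n} {e f} → IsImage φ e f → ∀ x → x ∈ e → φ x ∈ f
image-maps img x x∈e = Equivalence.from (img _) (x , x∈e , refl)

image-covers : ∀ {φ : Fin m → Fin n} {e f} → IsImage φ e f →
  ∀ y → y ∈ f → Σ (Fin m) λ x → x ∈ e × φ x ≡ y
image-covers img y = Equivalence.to (img y)

image-∘ : ∀ {k} {φ : Fin k → Fin m} {χ : Fin m → Fin n} {e f g} →
  IsImage φ e f → IsImage χ f g → IsImage (χ ∘ φ) e g
image-∘ {φ = φ} {χ} φ-img χ-img = mkImage
  (λ x → image-maps χ-img (φ x) ∘ image-maps φ-img x)
  λ y y∈g → let z , z∈f , χz≡y = image-covers χ-img y y∈g
                x , x∈e , φx≡z = image-covers φ-img z z∈f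
            in x , x∈e , trans (cong χ φx≡z) χz≡y

image-⊆ : ∀ {φ : Fin m → Fin n} {e e′ f} → Injective _≡_ _≡_ φ →
  IsImage φ e f → IsImage φ e′ f → ∀ {x} → x ∈ e → x ∈ e′
image-⊆ φ-inj img img′ {x} x∈e with image-covers img′ _ (image-maps img x x∈e)
... | x′ , x′∈e′ , φx′≡φx = subst (_∈ _) (φ-inj φx′≡φx) x′∈e′

image-unique : ∀ {φ : Fin m → Fin n} {e e′ f} → Injective _≡_ _≡_ φ →
  IsImage φ e f → IsImage φ e′ f → e ≡ e′
image-unique φ-inj img img′ = subset-ext λ _ → mk⇔ (image-⊆ φ-inj img img′) (image-⊆ φ-inj img′ img)

image-⁅⁆ : ∀ (ψ : Fin m → Fin n) j → IsImage ψ ⁅ j ⁆ ⁅ ψ j ⁆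
image-⁅⁆ ψ j = mkImage
  (λ x x∈⁅j⁆ → subst (λ z → ψ z ∈ ⁅ ψ j ⁆) (sym (x∈⁅y⁆⇒x≡y j x∈⁅j⁆)) (x∈⁅x⁆ (ψ j)))
  λ y y∈⁅ψj⁆ → j , x∈⁅x⁆ j , sym (x∈⁅y⁆⇒x≡y (ψ j) y∈⁅ψj⁆)

image-blow : ∀ {φ : Fin m → Fin n} {e f} → IsImage φ e f → IsImage (blowMap d φ) (blow d e) (blow d f)
image-blow {m} {n} {d} {φ} {e} {f} img = mkImage maps covers
  where
  maps : ∀ x → x ∈ blow d e → blowMap d φ x ∈ blow d f
  maps x x∈ with combineView m d x
  ... | pair u t = subst (_∈ blow d f) (sym (blowMap-combine φ u t))
    (Equivalence.from (∈-blow d f (φ u) t) (image-maps img u (Equivalence.to (∈-blow d e u t) x∈)))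
  covers : ∀ y → y ∈ blow d f → Σ _ λ x → x ∈ blow d e × blowMap d φ x ≡ y
  covers y y∈ with combineView n d y
  ... | pair v t with image-covers img v (Equivalence.to (∈-blow d f v t) y∈)
  ... | u , u∈e , φu≡v = combine u t , Equivalence.from (∈-blow d e u t) u∈e ,
                          trans (blowMap-combine φ u t) (cong (λ z → combine z t) φu≡v)

image-⊕ : ∀ {φ : Fin m → Fin n} {χ : Fin m′ → Fin n′} {e f e′ f′} →
  IsImage φ e f → IsImage χ e′ f′ → IsImage (φ ⊕ χ) (e ++ e′) (f ++ f′)
image-⊕ {m} {n} {m′} {n′} {φ} {χ} {e} {f} {e′} {f′} φ-img χ-img = mkImage maps covers
  where
  maps : ∀ x → x ∈ e ++ e′ → (φ ⊕ χ) x ∈ f ++ f′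
  maps x x∈ with splitView m x
  ... | inl u = subst (_∈ f ++ f′) (sym (⊕-↑ˡ φ χ u))
    (Equivalence.from (∈-++ˡ f f′ (φ u)) (image-maps φ-img u (Equivalence.to (∈-++ˡ e e′ u) x∈)))
  ... | inr u = subst (_∈ f ++ f′) (sym (⊕-↑ʳ φ χ u))
    (Equivalence.from (∈-++ʳ f f′ (χ u)) (image-maps χ-img u (Equivalence.to (∈-++ʳ e e′ u) x∈)))
  covers : ∀ y → y ∈ f ++ f′ → Σ _ λ x → x ∈ e ++ e′ × (φ ⊕ χ) x ≡ y
  covers y y∈ with splitView n y
  ... | inl v with image-covers φ-img v (Equivalence.to (∈-++ˡ f f′ v) y∈)
  ... | u , u∈ , eq = u ↑ˡ m′ , Equivalence.from (∈-++ˡ e e′ u) u∈ , trans (⊕-↑ˡ φ χ u) (cong (_↑ˡ n′) eq)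
  covers y y∈ | inr v with image-covers χ-img v (Equivalence.to (∈-++ʳ f f′ v) y∈)
  ... | u , u∈ , eq = m ↑ʳ u , Equivalence.from (∈-++ʳ e e′ u) u∈ , trans (⊕-↑ʳ φ χ u) (cong (n ↑ʳ_) eq)

image-lift : ∀ {φ : Fin m → Fin n} {e f} → IsImage φ e f → IsImage (lift 1 φ) (inside ∷ e) (inside ∷ f)
image-lift {φ = φ} img = mkImage maps covers
  where
  maps : ∀ x → x ∈ inside ∷ _ → lift 1 φ x ∈ inside ∷ _
  maps zero    _         = here
  maps (suc x) (there x∈) = there (image-maps img x x∈)
  covers : ∀ y → y ∈ inside ∷ _ → Σ _ λ x → x ∈ inside ∷ _ × lift 1 φ x ≡ y
  covers zero    _          = zero , here , refl
  covers (suc y) (there y∈) with image-covers img y y∈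
  ... | x , x∈ , refl = suc x , there x∈ , refl

record Embeds (H G : Hypergraph) (ψ : Fin (nE H) → Fin (nE G)) : Set where
  constructor embeds
  field
    vertexMap  : Fin (nV H) → Fin (nV G)
    injective  : Injective _≡_ _≡_ vertexMap
    image      : ∀ j → IsImage vertexMap (edge H j) (edge G (ψ j))

embeds-∘ : ∀ {H K G τ ψ} → Embeds H K τ → Embeds K G ψ → Embeds H G (ψ ∘ τ)
embeds-∘ {τ = τ} (embeds φ φ-inj φ-img) (embeds χ χ-inj χ-img) =
  embeds (χ ∘ φ) (φ-inj ∘ χ-inj) λ j → image-∘ (φ-img j) (χ-img (τ j))

embeds-edgeInjective : ∀ {H G ψ} → Embeds H G ψ → Injective _≡_ _≡_ (edge H) → Injective _≡_ _≡_ ψ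
embeds-edgeInjective {H} {G} (embeds φ φ-inj φ-img) edge-inj {i} {j} ψi≡ψj =
  edge-inj (image-unique φ-inj (φ-img i) (subst (IsImage φ (edge H j) ∘ edge G) (sym ψi≡ψj) (φ-img j)))

embeds-byBijection : ∀ {H G ψ} (θ : Fin (nV G) → Fin (nV H)) →
  Injective _≡_ _≡_ θ → StrictlySurjective _≡_ θ →
  (∀ j y → y ∈ edge G (ψ j) ⇔ θ y ∈ edge H j) → Embeds H G ψ
embeds-byBijection {H} {G} {ψ} θ θ-inj θ-surj mem = embeds φ φ-inj λ j → mkImage (maps j) (covers j)
  where
  φ : Fin (nV H) → Fin (nV G)
  φ x = proj₁ (θ-surj x)
  θφ : ∀ x → θ (φ x) ≡ x
  θφ x = proj₂ (θ-surj x)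
  φ-inj : Injective _≡_ _≡_ φ
  φ-inj {x} {x′} eq = trans (sym (θφ x)) (trans (cong θ eq) (θφ x′))
  maps : ∀ j x → x ∈ edge H j → φ x ∈ edge G (ψ j)
  maps j x x∈ = Equivalence.from (mem j (φ x)) (subst (_∈ edge H j) (sym (θφ x)) x∈)
  covers : ∀ j y → y ∈ edge G (ψ j) → Σ _ λ x → x ∈ edge H j × φ x ≡ y
  covers j y y∈ = θ y , Equivalence.to (mem j y) y∈ , θ-inj (θφ (θ y))

-- Constructions keeping the edge set

onEdges : (G : Hypergraph) → (Fin (nE G) → Subset n) → Hypergraph
onEdges {n} G E = record { nV = n ; nE = nE G ; edge = E }

blowup : ℕ → Hypergraph → Hypergraph
blowup d G = onEdges G λ e → blow d (edge G e)

pad : ℕ → Hypergraph → Hypergraph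
pad w G = onEdges G λ e → edge G e ++ blow w ⁅ e ⁆

cone : Hypergraph → Hypergraph
cone G = onEdges G λ e → inside ∷ edge G e

blowup-isKGraph : ∀ {k G} → IsKGraph k G → IsKGraph (k * suc d) (blowup (suc d) G)
blowup-isKGraph {d} {k} {G} (size , edge-inj) =
  (λ e → trans (∣blow∣ (suc d) (edge G e)) (cong (_* suc d) (size e))) , edge-inj ∘ blow-injective

pad-isKGraph : ∀ {k G} → IsKGraph k G → IsKGraph (k + w) (pad w G)
pad-isKGraph {w} {k} {G} (size , edge-inj) =
  (λ e → trans (∣++∣ (edge G e) (blow w ⁅ e ⁆))
           (cong₂ _+_ (size e) (trans (∣blow∣ w ⁅ e ⁆) (trans (cong (_* w) (∣⁅x⁆∣≡1 e)) (+-identityʳ w))))) ,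
  λ {e} {e′} → edge-inj ∘ ++-injectiveˡ (edge G e) (edge G e′)

cone-isKGraph : ∀ {k G} → IsKGraph k G → IsKGraph (suc k) (cone G)
cone-isKGraph (size , edge-inj) = cong suc ∘ size , edge-inj ∘ ∷-injectiveʳ

blowup-embeds : ∀ {H G ψ} → Embeds H G ψ → Embeds (blowup d H) (blowup d G) ψ
blowup-embeds (embeds φ φ-inj φ-img) = embeds (blowMap _ φ) (blowMap-injective φ-inj) (image-blow ∘ φ-img)

-- The padding of an edge goes to the padding of its image, so ψ must be injective.
pad-embeds : ∀ {H G ψ} → Injective _≡_ _≡_ ψ → Embeds H G ψ → Embeds (pad w H) (pad w G) ψ
pad-embeds {ψ = ψ} ψ-inj (embeds φ φ-inj φ-img) =
  embeds (φ ⊕ blowMap _ ψ) (⊕-injective φ-inj (blowMap-injective ψ-inj)) λ j → image-⊕ (φ-img j) (image-blow (image-⁅⁆ ψ j))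

cone-embeds : ∀ {H G ψ} → Embeds H G ψ → Embeds (cone H) (cone G) ψ
cone-embeds (embeds φ φ-inj φ-img) = embeds (lift 1 φ) (lift-injective φ φ-inj 1) (image-lift ∘ φ-img)

∈-pad-old : ∀ {G} (x : Fin (nV G)) j → x ↑ˡ nE G * w ∈ edge (pad w G) j ⇔ x ∈ edge G j
∈-pad-old {w} {G} x j = ∈-++ˡ (edge G j) (blow w ⁅ j ⁆) x

∈-pad-padding : ∀ {G} (e : Fin (nE G)) (t : Fin w) j → nV G ↑ʳ combine e t ∈ edge (pad w G) j ⇔ e ≡ j
∈-pad-padding {w} {G} e t j = x∈⁅y⁆⇔x≡y ⇔-∘ (∈-blow w ⁅ j ⁆ e t ⇔-∘ ∈-++ʳ (edge G j) (blow w ⁅ j ⁆) (combine e t))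

data BlowupPadView (N ℓ M w : ℕ) : Fin (N * ℓ + M * w) → Set where
  copy    : (v : Fin N) (t : Fin ℓ) → BlowupPadView N ℓ M w (combine v t ↑ˡ M * w)
  padding : (e : Fin M) (t : Fin w) → BlowupPadView N ℓ M w (N * ℓ ↑ʳ combine e t)

blowupPadView : ∀ N ℓ M w y → BlowupPadView N ℓ M w y
blowupPadView N ℓ M w y with splitView (N * ℓ) y
... | inl u with combineView N ℓ u
...   | pair v t = copy v t
blowupPadView N ℓ M w y | inr u with combineView M w u
...   | pair e t = padding e t

*+<suc* : ∀ {t n} q → t < n → q * n + t < suc q * n
*+<suc* {t} {n} q t<n = subst (q * n + t <_) (+-comm (q * n) n) (+-monoʳ-< (q * n) t<n)

*≤*+⇔≤ : ∀ {t n} a q → t < n → a * n ≤ q * n + t ⇔ a ≤ q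
*≤*+⇔≤ {t} {n} a q t<n = mk⇔
  (λ as≤ → s≤s⁻¹ (*-cancelʳ-< n a (suc q) (≤-<-trans as≤ (*+<suc* q t<n))))
  (λ a≤q → ≤-trans (*-monoˡ-≤ n a≤q) (m≤m+n (q * n) t))

*+<*⇔< : ∀ {t n} q b → t < n → q * n + t < b * n ⇔ q < b
*+<*⇔< {t} {n} q b t<n = mk⇔
  (λ lt → *-cancelʳ-< n q b (≤-<-trans (m≤m+n (q * n) t) lt))
  (λ q<b → <-≤-trans (*+<suc* q t<n) (*-monoˡ-≤ n q<b))

*+-injective : ∀ {t t′ n} q q′ → t < n → t′ < n → q * n + t ≡ q′ * n + t′ → q ≡ q′ × t ≡ t′
*+-injective {t} {t′} {n} q q′ t<n t′<n eq = q≡q′ , +-cancelˡ-≡ (q * n) t t′ (trans eq (cong (λ z → z * n + t′) (sym q≡q′)))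
  where
  q≡q′ : q ≡ q′
  q≡q′ = ≤-antisym (Equivalence.to (*≤*+⇔≤ q q′ t′<n) (subst (q * n ≤_) eq (m≤m+n (q * n) t)))
                   (Equivalence.to (*≤*+⇔≤ q′ q t<n) (subst (q′ * n ≤_) (sym eq) (m≤m+n (q′ * n) t′)))

*+<*+⇔≤ : ∀ {t c n} q b → t < c → c ≤ n → q * n + t < b * n + c ⇔ q ≤ b
*+<*+⇔≤ {t} {c} {n} q b t<c c≤n = mk⇔
  (λ lt → s≤s⁻¹ (Equivalence.to (*+<*⇔< q (suc b) (<-≤-trans t<c c≤n))
                   (<-≤-trans lt (subst (b * n + c ≤_) (+-comm (b * n) n) (+-monoʳ-≤ (b * n) c≤n)))))
  (λ q≤b → <-≤-trans (+-monoʳ-< (q * n) t<c) (+-monoˡ-≤ c (*-monoˡ-≤ n q≤b)))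

+-cancelˡ-<⇔ : ∀ a {b c} → a + b < a + c ⇔ b < c
+-cancelˡ-<⇔ a = mk⇔ (+-cancelˡ-< a _ _) (+-monoʳ-< a)

-- Paths

T-≤ᵇ : ∀ {m n} → T (m ≤ᵇ n) ⇔ m ≤ n
T-≤ᵇ = mk⇔ (≤ᵇ⇒≤ _ _) ≤⇒≤ᵇ

T-<ᵇ : ∀ {m n} → T (m <ᵇ n) ⇔ m < n
T-<ᵇ = mk⇔ (<ᵇ⇒< _ _) <⇒<ᵇ

∈-kPath : ∀ k ℓ {m} j x → x ∈ edge (kPath k ℓ m) j ⇔ (toℕ j * (k ∸ ℓ) ≤ toℕ x × toℕ x < toℕ j * (k ∸ ℓ) + k)
∈-kPath k ℓ j x = (T-≤ᵇ ×-⇔ T-<ᵇ) ⇔-∘ (T-∧ ⇔-∘ ∈-tabulate _ x)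

∈-kPath-at : ∀ k ℓ {m} j x {X s} → toℕ x ≡ X → k ∸ ℓ ≡ s →
  x ∈ edge (kPath k ℓ m) j ⇔ (toℕ j * s ≤ X × X < toℕ j * s + k)
∈-kPath-at k ℓ j x refl refl = ∈-kPath k ℓ j x

∈-graphPath : ∀ {n} j x → x ∈ edge (graphPath n) j ⇔ (toℕ j ≤ toℕ x × toℕ x ≤ suc (toℕ j))
∈-graphPath j x = (T-≤ᵇ ×-⇔ T-≤ᵇ) ⇔-∘ (T-∧ ⇔-∘ ∈-tabulate _ x)

graphPath-edgeInjective : ∀ n → Injective _≡_ _≡_ (edge (graphPath n))
graphPath-edgeInjective (suc n) eq = toℕ-injective (≤-antisym (below (sym eq)) (below eq))
  where
  inject₁∈ : ∀ i → inject₁ i ∈ edge (graphPath (suc n)) i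
  inject₁∈ i = Equivalence.from (∈-graphPath i (inject₁ i))
    (subst (λ x → toℕ i ≤ x × x ≤ suc (toℕ i)) (sym (toℕ-inject₁ i)) (≤-refl , n≤1+n _))
  below : ∀ {i j} → edge (graphPath (suc n)) i ≡ edge (graphPath (suc n)) j → toℕ j ≤ toℕ i
  below {i} {j} eq = subst (toℕ j ≤_) (toℕ-inject₁ i)
    (proj₁ (Equivalence.to (∈-graphPath j (inject₁ i)) (subst (inject₁ i ∈_) eq (inject₁∈ i))))

toℕ-punchIn-< : ∀ {n} (i : Fin (suc n)) (j : Fin n) → toℕ j < toℕ i → toℕ (punchIn i j) ≡ toℕ j
toℕ-punchIn-< (suc i) zero    _         = refl
toℕ-punchIn-< (suc i) (suc j) (s≤s j<i) = cong suc (toℕ-punchIn-< i j j<i)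

toℕ-punchIn-≥ : ∀ {n} (i : Fin (suc n)) (j : Fin n) → toℕ i ≤ toℕ j → toℕ (punchIn i j) ≡ suc (toℕ j)
toℕ-punchIn-≥ zero    j       _         = refl
toℕ-punchIn-≥ (suc i) (suc j) (s≤s i≤j) = cong suc (toℕ-punchIn-≥ i j i≤j)

-- Vertex k of the (k + 1, ℓ + 1)-path lies in every edge since m (k ∸ ℓ) ≤ k; deleting it leaves the
-- (k, ℓ)-path, so θ sends the apex to k.
module _ (k ℓ m : ℕ) (m[k∸ℓ]≤k : m * (k ∸ ℓ) ≤ k) where
  private
    s = k ∸ ℓ
    apex : Fin (suc (k + m * s))
    apex = fromℕ< (s≤s (m≤m+n k (m * s)))
    toℕapex : toℕ apex ≡ k
    toℕapex = toℕ-fromℕ< (s≤s (m≤m+n k (m * s)))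

    θ : Fin (suc (k + m * s)) → Fin (suc (k + m * s))
    θ zero    = apex
    θ (suc y) = punchIn apex y

    θ-injective : Injective _≡_ _≡_ θ
    θ-injective {zero}  {zero}   _  = refl
    θ-injective {zero}  {suc y}  eq = ⊥-elim (punchInᵢ≢i apex y (sym eq))
    θ-injective {suc y} {zero}   eq = ⊥-elim (punchInᵢ≢i apex y eq)
    θ-injective {suc y} {suc y′} eq = cong suc (punchIn-injective apex y y′ eq)

    θ-surjective : StrictlySurjective _≡_ θ
    θ-surjective x with apex ≟ x
    ... | yes apex≡x = zero , apex≡x
    ... | no  apex≢x = suc (punchOut apex≢x) , punchIn-punchOut apex≢x

    js≤k : ∀ (j : Fin (suc m)) → toℕ j * s ≤ k
    js≤k j = ≤-trans (*-monoˡ-≤ s (s≤s⁻¹ (toℕ<n j))) m[k∸ℓ]≤k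

    shift : ∀ (j : Fin (suc m)) y →
      (toℕ j * s ≤ toℕ y × toℕ y < toℕ j * s + k) ⇔
      (toℕ j * s ≤ toℕ (punchIn apex y) × toℕ (punchIn apex y) < toℕ j * s + suc k)
    shift j y with toℕ y <? k
    ... | yes y<k rewrite toℕ-punchIn-< apex y (subst (toℕ y <_) (sym toℕapex) y<k) =
      ⇔-id _ ×-⇔ mk⇔ (const (<-≤-trans y<k (≤-trans (n≤1+n k) (m≤n+m (suc k) _))))
                     (const (<-≤-trans y<k (m≤n+m k _)))
    ... | no  y≮k rewrite toℕ-punchIn-≥ apex y (subst (_≤ toℕ y) (sym toℕapex) (≮⇒≥ y≮k)) =
      mk⇔ (const (≤-trans (js≤k j) (≤-trans (≮⇒≥ y≮k) (n≤1+n _)))) (const (≤-trans (js≤k j) (≮⇒≥ y≮k))) ×-⇔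
      mk⇔ (λ lt → subst (suc (toℕ y) <_) (sym (+-suc _ k)) (s≤s lt)) (λ lt → s≤s⁻¹ (subst (suc (toℕ y) <_) (+-suc _ k) lt))

    membership : ∀ j y → y ∈ inside ∷ edge (kPath k ℓ (suc m)) j ⇔ θ y ∈ edge (kPath (suc k) (suc ℓ) (suc m)) j
    membership j zero = mk⇔ (const apex∈) (const here)
      where
      apex∈ : apex ∈ edge (kPath (suc k) (suc ℓ) (suc m)) j
      apex∈ = Equivalence.from (∈-kPath (suc k) (suc ℓ) j apex)
        (subst (toℕ j * s ≤_) (sym toℕapex) (js≤k j) ,
         subst (_< toℕ j * s + suc k) (sym toℕapex) (<-≤-trans (n<1+n k) (m≤n+m (suc k) _)))
    membership j (suc y) = begin
      suc y ∈ inside ∷ edge (kPath k ℓ (suc m)) j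
        ∼⟨ ∈-cong-lookup refl ⟩
      y ∈ edge (kPath k ℓ (suc m)) j
        ∼⟨ ∈-kPath k ℓ j y ⟩
      (toℕ j * s ≤ toℕ y × toℕ y < toℕ j * s + k)
        ∼⟨ shift j y ⟩
      (toℕ j * s ≤ toℕ (punchIn apex y) × toℕ (punchIn apex y) < toℕ j * s + suc k)
        ∼⟨ ⇔-sym (∈-kPath (suc k) (suc ℓ) j (punchIn apex y)) ⟩
      punchIn apex y ∈ edge (kPath (suc k) (suc ℓ) (suc m)) j
        ∎
      where open EquationalReasoning

  kPath-cone : Embeds (kPath (suc k) (suc ℓ) (suc m)) (cone (kPath k ℓ (suc m))) id
  kPath-cone = embeds-byBijection θ θ-injective θ-surjective membership

module _ (k ℓ m d : ℕ) where
  private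
    s = k ∸ ℓ
    sd≡ : k * d ∸ ℓ * d ≡ s * d
    sd≡ = sym (*-distribʳ-∸ d k ℓ)
    size≡ : (k + (m ∸ 1) * s) * d ≡ k * d + (m ∸ 1) * (k * d ∸ ℓ * d)
    size≡ = begin
      (k + (m ∸ 1) * s) * d           ≡⟨ *-distribʳ-+ d k ((m ∸ 1) * s) ⟩
      k * d + (m ∸ 1) * s * d         ≡⟨ cong (k * d +_) (*-assoc (m ∸ 1) s d) ⟩
      k * d + (m ∸ 1) * (s * d)       ≡⟨ cong (λ z → k * d + (m ∸ 1) * z) sd≡ ⟨
      k * d + (m ∸ 1) * (k * d ∸ ℓ * d) ∎
      where open ≡-Reasoning

    θ : Fin ((k + (m ∸ 1) * s) * d) → Fin (k * d + (m ∸ 1) * (k * d ∸ ℓ * d))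
    θ = cast size≡

    θ-injective : Injective _≡_ _≡_ θ
    θ-injective {x} {y} eq = toℕ-injective (trans (sym (toℕ-cast size≡ x)) (trans (cong toℕ eq) (toℕ-cast size≡ y)))

    θ-surjective : StrictlySurjective _≡_ θ
    θ-surjective x = cast (sym size≡) x , cast-involutive size≡ (sym size≡) x

    membership : ∀ j y → y ∈ blow d (edge (kPath k ℓ m) j) ⇔ θ y ∈ edge (kPath (k * d) (ℓ * d) m) j
    membership j y with combineView (k + (m ∸ 1) * s) d y
    ... | pair q t = begin
      combine q t ∈ blow d (edge (kPath k ℓ m) j)
        ∼⟨ ∈-blow d _ q t ⟩
      q ∈ edge (kPath k ℓ m) j
        ∼⟨ ∈-kPath k ℓ j q ⟩
      (J * s ≤ toℕ q × toℕ q < J * s + k)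
        ∼⟨ ⇔-sym (*≤*+⇔≤ (J * s) (toℕ q) (toℕ<n t) ×-⇔ *+<*⇔< (toℕ q) (J * s + k) (toℕ<n t)) ⟩
      (J * s * d ≤ X × X < (J * s + k) * d)
        ≡⟨ cong₂ (λ a b → a ≤ X × X < b) (*-assoc J s d) (trans (*-distribʳ-+ d (J * s) k) (cong (_+ k * d) (*-assoc J s d))) ⟩
      (J * (s * d) ≤ X × X < J * (s * d) + k * d)
        ∼⟨ ⇔-sym (∈-kPath-at (k * d) (ℓ * d) j (θ (combine q t)) toℕθ sd≡) ⟩
      θ (combine q t) ∈ edge (kPath (k * d) (ℓ * d) m) j
        ∎
      where
      open EquationalReasoning
      J = toℕ j
      X = toℕ q * d + toℕ t
      toℕθ : toℕ (θ (combine q t)) ≡ X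
      toℕθ = trans (toℕ-cast size≡ (combine q t)) (trans (toℕ-combine q t) (cong (_+ toℕ t) (*-comm d (toℕ q))))

  kPath-blowup : Embeds (kPath (k * d) (ℓ * d) m) (blowup d (kPath k ℓ m)) id
  kPath-blowup = embeds-byBijection θ θ-injective θ-surjective membership

-- A vertex of the path is i s + t with s = ℓ + w and t < s; for t < ℓ it is copy t of vertex i
-- of the graph path, otherwise it is padding vertex t - ℓ of edge i.
module _ (ℓ w m : ℕ) {{_ : NonZero (ℓ + w)}} where
  private
    s = ℓ + w
    k = 2 * ℓ + w
    P = graphPath (suc (suc m))
    H = kPath k ℓ (suc m)
    Q = pad w (blowup ℓ P)

    k≡ℓ+s : k ≡ ℓ + s
    k≡ℓ+s = trans (+-assoc ℓ (ℓ + 0) w) (cong (λ z → ℓ + (z + w)) (+-identityʳ ℓ))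

    k∸ℓ≡s : k ∸ ℓ ≡ s
    k∸ℓ≡s = trans (cong (_∸ ℓ) k≡ℓ+s) (m+n∸m≡n ℓ s)

    size≡ : nV H ≡ ℓ + suc m * s
    size≡ = trans (cong₂ (λ a b → a + m * b) k≡ℓ+s k∸ℓ≡s) (+-assoc ℓ s (m * s))

    ℓ+[1+J]s≡Js+k : ∀ J → ℓ + suc J * s ≡ J * s + k
    ℓ+[1+J]s≡Js+k J = trans (sym (+-assoc ℓ s (J * s))) (trans (+-comm (ℓ + s) (J * s)) (cong (J * s +_) (sym k≡ℓ+s)))

    ℓ+t<s : ∀ (t : Fin w) → ℓ + toℕ t < s
    ℓ+t<s t = +-monoʳ-< ℓ (toℕ<n t)

    t<s : ∀ (t : Fin ℓ) → toℕ t < s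
    t<s t = <-≤-trans (toℕ<n t) (m≤m+n ℓ w)

    copyPos : Fin (suc (suc m)) → Fin ℓ → ℕ
    copyPos v t = toℕ v * s + toℕ t

    paddingPos : Fin (suc m) → Fin w → ℕ
    paddingPos e t = toℕ e * s + (ℓ + toℕ t)

    copyPos< : ∀ v t → copyPos v t < nV H
    copyPos< v t = subst (copyPos v t <_) (sym size≡) (subst (copyPos v t <_) (+-comm _ ℓ)
      (<-≤-trans (+-monoʳ-< (toℕ v * s) (toℕ<n t)) (+-monoˡ-≤ ℓ (*-monoˡ-≤ s (s≤s⁻¹ (toℕ<n v))))))

    paddingPos< : ∀ e t → paddingPos e t < nV H
    paddingPos< e t = subst (paddingPos e t <_) (sym size≡) (<-≤-trans (*+<suc* (toℕ e) (ℓ+t<s t))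
      (≤-trans (*-monoˡ-≤ s (toℕ<n e)) (m≤n+m _ ℓ)))

    θcopy : Fin (suc (suc m)) × Fin ℓ → Fin (nV H)
    θcopy (v , t) = fromℕ< (copyPos< v t)

    θpadding : Fin (suc m) × Fin w → Fin (nV H)
    θpadding (e , t) = fromℕ< (paddingPos< e t)

    θ : Fin (nV Q) → Fin (nV H)
    θ = [ θcopy ∘ remQuot ℓ , θpadding ∘ remQuot w ]′ ∘ splitAt (suc (suc m) * ℓ)

    toℕθ-copy : ∀ v t → toℕ (θ (combine v t ↑ˡ _)) ≡ copyPos v t
    toℕθ-copy v t = trans (cong toℕ (trans
      (cong [ θcopy ∘ remQuot ℓ , θpadding ∘ remQuot w ]′ (splitAt-↑ˡ (suc (suc m) * ℓ) (combine v t) _))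
      (cong θcopy (remQuot-combine v t)))) (toℕ-fromℕ< (copyPos< v t))

    toℕθ-padding : ∀ e t → toℕ (θ (suc (suc m) * ℓ ↑ʳ combine e t)) ≡ paddingPos e t
    toℕθ-padding e t = trans (cong toℕ (trans
      (cong [ θcopy ∘ remQuot ℓ , θpadding ∘ remQuot w ]′ (splitAt-↑ʳ (suc (suc m) * ℓ) _ (combine e t)))
      (cong θpadding (remQuot-combine e t)))) (toℕ-fromℕ< (paddingPos< e t))

    padding≢copy : ∀ e t v t′ → paddingPos e t ≢ copyPos v t′
    padding≢copy e t v t′ eq with *+-injective (toℕ e) (toℕ v) (ℓ+t<s t) (t<s t′) eq
    ... | _ , ℓ+t≡t′ = <-irrefl refl (≤-<-trans (m≤m+n ℓ (toℕ t)) (subst (_< ℓ) (sym ℓ+t≡t′) (toℕ<n t′)))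

    θ-injective : Injective _≡_ _≡_ θ
    θ-injective {y} {y′} eq with blowupPadView (suc (suc m)) ℓ (suc m) w y | blowupPadView (suc (suc m)) ℓ (suc m) w y′
    ... | copy v t | copy v′ t′
      with *+-injective (toℕ v) (toℕ v′) (t<s t) (t<s t′)
             (trans (sym (toℕθ-copy v t)) (trans (cong toℕ eq) (toℕθ-copy v′ t′)))
    ...   | v≡v′ , t≡t′ = cong₂ (λ a b → combine a b ↑ˡ _) (toℕ-injective v≡v′) (toℕ-injective t≡t′)
    θ-injective {y} {y′} eq | padding e t | padding e′ t′
      with *+-injective (toℕ e) (toℕ e′) (ℓ+t<s t) (ℓ+t<s t′)
             (trans (sym (toℕθ-padding e t)) (trans (cong toℕ eq) (toℕθ-padding e′ t′)))
    ...   | e≡e′ , ℓ+t≡ℓ+t′ =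
      cong₂ (λ a b → suc (suc m) * ℓ ↑ʳ combine a b) (toℕ-injective e≡e′) (toℕ-injective (+-cancelˡ-≡ ℓ _ _ ℓ+t≡ℓ+t′))
    θ-injective {y} {y′} eq | padding e t | copy v t′ =
      ⊥-elim (padding≢copy e t v t′ (trans (sym (toℕθ-padding e t)) (trans (cong toℕ eq) (toℕθ-copy v t′))))
    θ-injective {y} {y′} eq | copy v t | padding e t′ =
      ⊥-elim (padding≢copy e t′ v t (trans (sym (toℕθ-padding e t′)) (trans (cong toℕ (sym eq)) (toℕθ-copy v t))))

    module Preimage (x : Fin (nV H)) where
      X = toℕ x
      q = X / s
      r = X % s

      X≡qs+r : X ≡ q * s + r
      X≡qs+r = trans (m≡m%n+[m/n]*n X s) (+-comm r (q * s))

      qs+r< : q * s + r < ℓ + suc m * s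
      qs+r< = subst₂ _<_ X≡qs+r size≡ (toℕ<n x)

      ofCopy : (r<ℓ : r < ℓ) → Σ (Fin (nV Q)) λ y → θ y ≡ x
      ofCopy r<ℓ = combine (fromℕ< q<) (fromℕ< r<ℓ) ↑ˡ _ , toℕ-injective (begin
        toℕ (θ (combine (fromℕ< q<) (fromℕ< r<ℓ) ↑ˡ _)) ≡⟨ toℕθ-copy (fromℕ< q<) (fromℕ< r<ℓ) ⟩
        toℕ (fromℕ< q<) * s + toℕ (fromℕ< r<ℓ)          ≡⟨ cong₂ (λ a b → a * s + b) (toℕ-fromℕ< q<) (toℕ-fromℕ< r<ℓ) ⟩
        q * s + r                                       ≡⟨ X≡qs+r ⟨
        X                                               ∎)
        where
        open ≡-Reasoning
        q< : q < suc (suc m)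
        q< = Equivalence.to (*+<*⇔< q (suc (suc m)) (m%n<n X s))
               (<-≤-trans qs+r< (+-monoˡ-≤ (suc m * s) (m≤m+n ℓ w)))

      ofPadding : ℓ ≤ r → Σ (Fin (nV Q)) λ y → θ y ≡ x
      ofPadding ℓ≤r = suc (suc m) * ℓ ↑ʳ combine (fromℕ< q<) (fromℕ< r∸ℓ<w) , toℕ-injective (begin
        toℕ (θ (suc (suc m) * ℓ ↑ʳ combine (fromℕ< q<) (fromℕ< r∸ℓ<w))) ≡⟨ toℕθ-padding (fromℕ< q<) (fromℕ< r∸ℓ<w) ⟩
        toℕ (fromℕ< q<) * s + (ℓ + toℕ (fromℕ< r∸ℓ<w))  ≡⟨ cong₂ (λ a b → a * s + (ℓ + b)) (toℕ-fromℕ< q<) (toℕ-fromℕ< r∸ℓ<w) ⟩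
        q * s + (ℓ + (r ∸ ℓ))                            ≡⟨ cong (q * s +_) (m+[n∸m]≡n ℓ≤r) ⟩
        q * s + r                                        ≡⟨ X≡qs+r ⟨
        X                                                ∎)
        where
        open ≡-Reasoning
        r∸ℓ<w : r ∸ ℓ < w
        r∸ℓ<w = subst (r ∸ ℓ <_) (m+n∸m≡n ℓ w) (∸-monoˡ-< (m%n<n X s) ℓ≤r)
        q< : q < suc m
        q< = *-cancelʳ-< s q (suc m) (+-cancelˡ-< ℓ _ _ (subst (_< ℓ + suc m * s) (+-comm (q * s) ℓ)
               (≤-<-trans (+-monoʳ-≤ (q * s) ℓ≤r) qs+r<)))

    θ-surjective : StrictlySurjective _≡_ θ
    θ-surjective x with toℕ x % s <? ℓ
    ... | yes r<ℓ = Preimage.ofCopy x r<ℓ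
    ... | no  r≮ℓ = Preimage.ofPadding x (≮⇒≥ r≮ℓ)

    ∈-H : ∀ j x {X} → toℕ x ≡ X → x ∈ edge H j ⇔ (toℕ j * s ≤ X × X < toℕ j * s + k)
    ∈-H j x toℕx≡X = ∈-kPath-at k ℓ j x toℕx≡X k∸ℓ≡s

    ∈-copy : ∀ j v t → combine v t ↑ˡ _ ∈ edge Q j ⇔ θ (combine v t ↑ˡ _) ∈ edge H j
    ∈-copy j v t = begin
      combine v t ↑ˡ _ ∈ edge Q j
        ∼⟨ ∈-blow ℓ (edge P j) v t ⇔-∘ ∈-pad-old {G = blowup ℓ P} (combine v t) j ⟩
      v ∈ edge P j
        ∼⟨ ∈-graphPath j v ⟩
      (J ≤ V × V ≤ suc J)
        ∼⟨ ⇔-sym (*≤*+⇔≤ J V (t<s t) ×-⇔ *+<*+⇔≤ V (suc J) (toℕ<n t) (m≤m+n ℓ w)) ⟩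
      (J * s ≤ V * s + R × V * s + R < suc J * s + ℓ)
        ≡⟨ cong (λ b → J * s ≤ V * s + R × V * s + R < b) (trans (+-comm (suc J * s) ℓ) (ℓ+[1+J]s≡Js+k J)) ⟩
      (J * s ≤ V * s + R × V * s + R < J * s + k)
        ∼⟨ ⇔-sym (∈-H j _ (toℕθ-copy v t)) ⟩
      θ (combine v t ↑ˡ _) ∈ edge H j
        ∎
      where
      open EquationalReasoning
      J = toℕ j
      V = toℕ v
      R = toℕ t

    ∈-padding : ∀ j e t → suc (suc m) * ℓ ↑ʳ combine e t ∈ edge Q j ⇔ θ (suc (suc m) * ℓ ↑ʳ combine e t) ∈ edge H j
    ∈-padding j e t = begin
      suc (suc m) * ℓ ↑ʳ combine e t ∈ edge Q j
        ∼⟨ ∈-pad-padding {G = blowup ℓ P} e t j ⟩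
      e ≡ j
        ∼⟨ mk⇔ (λ { refl → ≤-refl , ≤-refl }) (λ (J≤E , E≤J) → toℕ-injective (≤-antisym E≤J J≤E)) ⟩
      (J ≤ E × E ≤ J)
        ∼⟨ ⇔-sym (*≤*+⇔≤ J E (ℓ+t<s t)) ×-⇔ mk⇔ s≤s s≤s⁻¹ ⟩
      (J * s ≤ E * s + (ℓ + R) × E < suc J)
        ∼⟨ ⇔-id _ ×-⇔ ⇔-sym (*+<*⇔< E (suc J) (<-≤-trans (toℕ<n t) (m≤n+m w ℓ))) ⟩
      (J * s ≤ E * s + (ℓ + R) × E * s + R < suc J * s)
        ∼⟨ ⇔-id _ ×-⇔ ⇔-sym (+-cancelˡ-<⇔ ℓ) ⟩
      (J * s ≤ E * s + (ℓ + R) × ℓ + (E * s + R) < ℓ + suc J * s)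
        ≡⟨ cong₂ (λ a b → J * s ≤ E * s + (ℓ + R) × a < b) (x∙yz≈y∙xz ℓ (E * s) R) (ℓ+[1+J]s≡Js+k J) ⟩
      (J * s ≤ E * s + (ℓ + R) × E * s + (ℓ + R) < J * s + k)
        ∼⟨ ⇔-sym (∈-H j _ (toℕθ-padding e t)) ⟩
      θ (suc (suc m) * ℓ ↑ʳ combine e t) ∈ edge H j
        ∎
      where
      open EquationalReasoning
      J = toℕ j
      E = toℕ e
      R = toℕ t

    membership : ∀ j y → y ∈ edge Q j ⇔ θ y ∈ edge H j
    membership j y with blowupPadView (suc (suc m)) ℓ (suc m) w y
    ... | copy v t    = ∈-copy j v t
    ... | padding e t = ∈-padding j e t

  kPath-thick : Embeds (kPath (2 * ℓ + w) ℓ (suc m)) (pad w (blowup ℓ (graphPath (suc (suc m))))) id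
  kPath-thick = embeds-byBijection θ θ-injective θ-surjective membership

-- Size-Ramsey numbers

arrows-onEdges : ∀ {r n H H′ G} {E : Fin (nE G) → Subset n} (τ : Fin (nE H) → Fin (nE H′)) →
  (∀ {ψ} → Embeds H′ G ψ → Embeds H (onEdges G E) (ψ ∘ τ)) → Arrows r G H′ → Arrows r (onEdges G E) H
arrows-onEdges τ extend G→H′ c with G→H′ c
... | φ , φ-inj , ψ , φ-img , a , mono with extend (embeds φ φ-inj φ-img)
... | embeds φ′ φ′-inj φ′-img = φ′ , φ′-inj , ψ ∘ τ , φ′-img , a , mono ∘ τ

sizeRamsey-≤ : ∀ {r k k′ H H′ a b} {N : Hypergraph → ℕ} (E : ∀ G → Fin (nE G) → Subset (N G))
  (τ : Fin (nE H) → Fin (nE H′)) →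
  (∀ {G} → IsKGraph k′ G → IsKGraph k (onEdges G (E G))) →
  (∀ {G ψ} → Embeds H′ G ψ → Embeds H (onEdges G (E G)) (ψ ∘ τ)) →
  IsSizeRamsey r k H a → IsSizeRamsey r k′ H′ b → a ≤ b
sizeRamsey-≤ E τ kgraph extend (_ , minimal) ((G , G-kgraph , refl , G→H′) , _) =
  minimal (onEdges G (E G)) (kgraph G-kgraph) (arrows-onEdges τ extend G→H′)

sizeRamsey-kPath≤graphPath : ∀ {r k ℓ m a b} → 1 ≤ ℓ → 2 * ℓ ≤ k → 1 ≤ m →
  IsSizeRamsey r k (kPath k ℓ m) a → IsSizeRamsey r 2 (graphPath (suc m)) b → a ≤ b
sizeRamsey-kPath≤graphPath {ℓ = suc ℓ₀} {suc m₀} _ 2ℓ≤k _ with m≤n⇒∃[o]m+o≡n 2ℓ≤k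
... | w , refl = sizeRamsey-≤ (λ G → edge (pad w (blowup (suc ℓ₀) G))) id (pad-isKGraph ∘ blowup-isKGraph) extend
  where
  extend : ∀ {G ψ} → Embeds (graphPath (suc (suc m₀))) G ψ →
    Embeds (kPath (2 * suc ℓ₀ + w) (suc ℓ₀) (suc m₀)) (pad w (blowup (suc ℓ₀) G)) ψ
  extend e = embeds-∘ (kPath-thick (suc ℓ₀) w m₀)
    (pad-embeds (embeds-edgeInjective e (graphPath-edgeInjective _)) (blowup-embeds e))

sizeRamsey-kPath≤kPath/d : ∀ {r k ℓ m d k′ ℓ′ a b} → 1 ≤ d → k ≡ k′ * d → ℓ ≡ ℓ′ * d →
  IsSizeRamsey r k (kPath k ℓ m) a → IsSizeRamsey r k′ (kPath k′ ℓ′ m) b → a ≤ b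
sizeRamsey-kPath≤kPath/d {m = m} {suc d} {k′} {ℓ′} _ refl refl =
  sizeRamsey-≤ (λ G → edge (blowup (suc d) G)) id blowup-isKGraph (embeds-∘ (kPath-blowup k′ ℓ′ m (suc d)) ∘ blowup-embeds)

sizeRamsey-kPath≤kPath∸1 : ∀ {r k ℓ m a b} → 1 ≤ ℓ → m * (k ∸ ℓ) < k →
  IsSizeRamsey r k (kPath k ℓ (suc m)) a → IsSizeRamsey r (k ∸ 1) (kPath (k ∸ 1) (ℓ ∸ 1) (suc m)) b → a ≤ b
sizeRamsey-kPath≤kPath∸1 {k = suc k₀} {suc ℓ₀} {m} _ (s≤s m[k₀∸ℓ₀]≤k₀) =
  sizeRamsey-≤ (λ G → edge (cone G)) id cone-isKGraph (embeds-∘ (kPath-cone k₀ ℓ₀ m m[k₀∸ℓ₀]≤k₀) ∘ cone-embeds)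

mainTheorem11 : (r k : ℕ) → 2 ≤ r → 2 ≤ k →
    ((ℓ m n : ℕ) → 1 ≤ ℓ → 2 * ℓ ≤ k → 1 ≤ m → n ≡ k + (m ∸ 1) * (k ∸ ℓ) →
      (a b : ℕ) → IsSizeRamsey r k (kPath k ℓ m) a →
      IsSizeRamsey r 2 (graphPath (suc m)) b → a ≤ b) ×
    ((ℓ m n d k' ℓ' n' : ℕ) → k ≤ n → 1 ≤ ℓ → ℓ < k → 1 ≤ d →
      1 ≤ m → n ≡ k + (m ∸ 1) * (k ∸ ℓ) →
      d ∣ n → d ∣ k → d ∣ ℓ → k ≡ k' * d → ℓ ≡ ℓ' * d → n ≡ n' * d →
      (a b : ℕ) → IsSizeRamsey r k (kPath k ℓ m) a →
      IsSizeRamsey r k' (kPath k' ℓ' m) b → a ≤ b) ×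
    ((ℓ m : ℕ) → 1 ≤ ℓ → ℓ < k → 1 ≤ m → m * (k ∸ ℓ) < k →
      (a b : ℕ) → IsSizeRamsey r k (kPath k ℓ (suc m)) a →
      IsSizeRamsey r (k ∸ 1) (kPath (k ∸ 1) (ℓ ∸ 1) (suc m)) b → a ≤ b)
mainTheorem11 r k _ _ =
  (λ ℓ m n 1≤ℓ 2ℓ≤k 1≤m _ a b → sizeRamsey-kPath≤graphPath 1≤ℓ 2ℓ≤k 1≤m) ,
  (λ ℓ m n d k′ ℓ′ n′ _ _ _ 1≤d _ _ _ _ _ k≡k′d ℓ≡ℓ′d _ a b → sizeRamsey-kPath≤kPath/d {ℓ′ = ℓ′} 1≤d k≡k′d ℓ≡ℓ′d) ,
  (λ ℓ m 1≤ℓ _ _ m[k∸ℓ]<k a b → sizeRamsey-kPath≤kPath∸1 1≤ℓ m[k∸ℓ]<k)
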